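{- Let $T\in\mathcal{Z}_+(\ell,t)$. Apply Gaussian elimination to $T$ as follows: for $k=1,2,\dots$ in turn, if the current entry in position $(k,k)$ is zero, do nothing; otherwise divide row $k$ by this entry and, for each $i\in[k+1,\ell]$, add the multiple of row $k$ that makes the entry in position $(i,k)$ zero. This yields a matrix $T'=YT$ where $T'\in\mathbb{R}^{\ell\times t}$ is upper triangular with every diagonal entry equal to $0$ or $1$ and all off-diagonal entries nonpositive, and all entries of $Y\in\mathbb{R}^{\ell\times\ell}$ are nonnegative. Moreover, if $T_{ik}<0$ for some $k\in[t]$ and $i\in[k+1,\ell]$, then $T'_{kk}=1$.
   Context: $\mathcal{Z}_+(\ell,t)$ is the set of matrices in $\mathbb{Q}^{\ell\times t}$ whose off-diagonal entries (entries $(i,j)$ with $i\ne j$) are all nonpositive and whose column sums are all nonnegative. For integers $k<\ell$, $[k,\ell]=\{k,k+1,\dots,\ell\}$ and $[t]=\{1,\dots,t\}$. -}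

module Defs where

open import Data.Nat as ℕ using (ℕ; zero; suc)
open import Data.Fin using (Fin; toℕ; fromℕ<)
open import Data.Rational
open import Data.Rational.Properties using (_≟_)
open import Data.Product using (_×_; _,_; proj₁; proj₂)
open import Relation.Nullary using (yes; no)
open import Data.Nat.Properties using (<-cmp)
open import Relation.Binary.Definitions using (tri<; tri≈; tri>)
open import Relation.Binary.PropositionalEquality using (_≡_)

-- An ℓ × t matrix over ℚ (rows indexed by Fin ℓ, columns by Fin t;
-- index 0 corresponds to the paper's index 1).
Mat : ℕ → ℕ → Set
Mat ℓ t = Fin ℓ → Fin t → ℚ

∑ : {n : ℕ} → (Fin n → ℚ) → ℚ
∑ {zero}  f = 0ℚ
∑ {suc n} f = f Fin.zero + ∑ (λ i → f (Fin.suc i))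
  where import Data.Fin as Fin

_⊗_ : {ℓ m t : ℕ} → Mat ℓ m → Mat m t → Mat ℓ t
(A ⊗ B) i j = ∑ (λ r → A i r * B r j)

Id : (ℓ : ℕ) → Mat ℓ ℓ
Id ℓ i j with toℕ i ℕ.≟ toℕ j
... | yes _ = 1ℚ
... | no  _ = 0ℚ

InZ+ : {ℓ t : ℕ} → Mat ℓ t → Set
InZ+ {ℓ} {t} T =
  (∀ (i : Fin ℓ) (j : Fin t) → toℕ i ≢ℕ toℕ j → T i j ≤ 0ℚ)
  × (∀ (j : Fin t) → 0ℚ ≤ ∑ (λ i → T i j))
  where
  open import Relation.Binary.PropositionalEquality using () renaming (_≢_ to _≢ℕ_)

-- One elimination step with pivot position (k,c) (toℕ k ≡ toℕ c), applied
-- simultaneously to the current matrix M and the accumulated transformation Y.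
pivotStep : {ℓ t : ℕ} → Fin ℓ → Fin t → Mat ℓ t × Mat ℓ ℓ → Mat ℓ t × Mat ℓ ℓ
pivotStep {ℓ} {t} k c (M , Y) with M k c ≟ 0ℚ
... | yes _   = M , Y
... | no p≢0  = rowop M , rowop Y
  where
  p = M k c
  instance
    nz : NonZero p
    nz = ≢-nonZero p≢0
  rowop : {m : ℕ} → Mat ℓ m → Mat ℓ m
  rowop A i j with <-cmp (toℕ i) (toℕ k)
  ... | tri< _ _ _ = A i j
  ... | tri≈ _ _ _ = A k j * 1/ p
  ... | tri> _ _ _ = A i j - M i c * (A k j * 1/ p)

stepℕ : {ℓ t : ℕ} → ℕ → Mat ℓ t × Mat ℓ ℓ → Mat ℓ t × Mat ℓ ℓ
stepℕ {ℓ} {t} k s with k ℕ.<? ℓ | k ℕ.<? t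
... | yes k<ℓ | yes k<t = pivotStep (fromℕ< k<ℓ) (fromℕ< k<t) s
... | _       | _       = s

loop : {ℓ t : ℕ} → ℕ → ℕ → Mat ℓ t × Mat ℓ ℓ → Mat ℓ t × Mat ℓ ℓ
loop zero    k s = s
loop (suc n) k s = loop n (suc k) (stepℕ k s)

gauss : {ℓ t : ℕ} → Mat ℓ t → Mat ℓ t × Mat ℓ ℓ
gauss {ℓ} T = loop ℓ 0 (T , Id ℓ)

gaussT' : {ℓ t : ℕ} → Mat ℓ t → Mat ℓ t
gaussT' T = proj₁ (gauss T)

gaussY : {ℓ t : ℕ} → Mat ℓ t → Mat ℓ ℓ
gaussY T = proj₂ (gauss T)

module Submission where

-- Throughout the elimination the unprocessed part of the current matrix stays in 𝒵₊: its
-- off-diagonal entries are ≤ 0 and its column sums over the unprocessed rows are ≥ 0. So each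
-- pivot p is ≥ 0, as it dominates such a column sum. If p = 0, the nonpositive entries below it
-- must all vanish. If p > 0, elimination adds to each row i below it the nonnegative multiple
-- - M i k / p of the pivot row, whose off-diagonal entries are ≤ 0: Y stays nonnegative,
-- off-diagonal entries only decrease, and the new column sums are nonnegative combinations of
-- the old ones. As entries below the diagonal only decrease, T i k < 0 rules out a zero pivot
-- in column k.

open import Defs
open import Data.Nat as ℕ using (ℕ; zero; suc; z≤n)
import Data.Nat.Properties as ℕP
open import Data.Fin as Fin using (Fin; toℕ; fromℕ<)
open import Data.Fin.Properties as FP using (toℕ-injective; toℕ<n; toℕ-fromℕ<; suc-injective)
open import Data.Rational
  using (ℚ; 0ℚ; 1ℚ; _≤_; _<_; _+_; _*_; -_; _-_; 1/_; NonZero; ≢-nonZero; nonNegative)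
import Data.Rational.Properties as ℚP
open import Data.Rational.Solver using (module +-*-Solver)
open import Algebra.Bundles using (CommutativeMonoid)
open import Algebra.Properties.CommutativeSemigroup
  (CommutativeMonoid.commutativeSemigroup ℚP.+-0-commutativeMonoid) using (interchange)
open import Data.Product using (_×_; _,_; proj₁; proj₂)
open import Data.Sum using (_⊎_; inj₁; inj₂)
open import Data.Empty using (⊥-elim)
open import Function using (_∘_)
open import Relation.Nullary using (Dec; yes; no)
open import Relation.Binary.Definitions using (tri<; tri≈; tri>)
open import Relation.Binary.PropositionalEquality
open +-*-Solver using (solve; _:=_; _:+_; _:*_; :-_; _:-_; con)

private variable
  a b : ℚ
  k ℓ m n t : ℕ

*-nonNeg : 0ℚ ≤ a → 0ℚ ≤ b → 0ℚ ≤ a * b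
*-nonNeg {a} {b} 0≤a 0≤b =
  subst (_≤ a * b) (ℚP.*-zeroʳ a) (ℚP.*-monoˡ-≤-nonNeg a {{nonNegative 0≤a}} 0≤b)

*-nonNeg-nonPos : 0ℚ ≤ a → b ≤ 0ℚ → a * b ≤ 0ℚ
*-nonNeg-nonPos {a} {b} 0≤a b≤0 =
  subst (a * b ≤_) (ℚP.*-zeroʳ a) (ℚP.*-monoˡ-≤-nonNeg a {{nonNegative 0≤a}} b≤0)

*-nonPos-nonNeg : a ≤ 0ℚ → 0ℚ ≤ b → a * b ≤ 0ℚ
*-nonPos-nonNeg {a} {b} a≤0 0≤b = subst (_≤ 0ℚ) (ℚP.*-comm b a) (*-nonNeg-nonPos 0≤b a≤0)

+-nonPos-≤ : b ≤ 0ℚ → a + b ≤ a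
+-nonPos-≤ {b} {a} b≤0 = subst (a + b ≤_) (ℚP.+-identityʳ a) (ℚP.+-monoʳ-≤ a b≤0)

inverse-nonNeg : 0ℚ ≤ a → a * b ≡ 1ℚ → 0ℚ ≤ b
inverse-nonNeg 0≤a ab≡1 = ℚP.≮⇒≥ λ b<0 →
  ℚP.<-irrefl refl (ℚP.≤-<-trans (subst (_≤ 0ℚ) ab≡1 (*-nonNeg-nonPos 0≤a (ℚP.<⇒≤ b<0)))
                                 (ℚP.positive⁻¹ 1ℚ))

∑-cong : {f g : Fin n → ℚ} → (∀ i → f i ≡ g i) → ∑ f ≡ ∑ g
∑-cong {zero}  f≗g = refl
∑-cong {suc n} f≗g = cong₂ _+_ (f≗g Fin.zero) (∑-cong (λ i → f≗g (Fin.suc i)))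

∑-+ : (f g : Fin n → ℚ) → ∑ (λ i → f i + g i) ≡ ∑ f + ∑ g
∑-+ {zero}  f g = refl
∑-+ {suc n} f g =
  trans (cong (f Fin.zero + g Fin.zero +_) (∑-+ (λ i → f (Fin.suc i)) (λ i → g (Fin.suc i))))
        (interchange (f Fin.zero) (g Fin.zero) _ _)

∑-*ˡ : (a : ℚ) (f : Fin n → ℚ) → ∑ (λ i → a * f i) ≡ a * ∑ f
∑-*ˡ {zero}  a f = sym (ℚP.*-zeroʳ a)
∑-*ˡ {suc n} a f = trans (cong (a * f Fin.zero +_) (∑-*ˡ a (λ i → f (Fin.suc i))))
                         (sym (ℚP.*-distribˡ-+ a _ _))

∑-zero : (f : Fin n → ℚ) → (∀ i → f i ≡ 0ℚ) → ∑ f ≡ 0ℚ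
∑-zero {zero}  f f≡0 = refl
∑-zero {suc n} f f≡0 = cong₂ _+_ (f≡0 Fin.zero) (∑-zero _ (λ i → f≡0 (Fin.suc i)))

∑-nonPos : (f : Fin n → ℚ) → (∀ i → f i ≤ 0ℚ) → ∑ f ≤ 0ℚ
∑-nonPos {zero}  f f≤0 = ℚP.≤-refl
∑-nonPos {suc n} f f≤0 = ℚP.+-mono-≤ (f≤0 Fin.zero) (∑-nonPos _ (λ i → f≤0 (Fin.suc i)))

∑-single : (f : Fin n → ℚ) (i : Fin n) → (∀ r → r ≢ i → f r ≡ 0ℚ) → ∑ f ≡ f i
∑-single {suc n} f Fin.zero    others≡0 =
  trans (cong (f Fin.zero +_) (∑-zero _ (λ r → others≡0 (Fin.suc r) λ ())))
        (ℚP.+-identityʳ _)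
∑-single {suc n} f (Fin.suc i) others≡0 =
  trans (cong₂ _+_ (others≡0 Fin.zero λ ())
                   (∑-single _ i (λ r r≢i → others≡0 (Fin.suc r) (r≢i ∘ suc-injective))))
        (ℚP.+-identityˡ _)

∑-≤-term : (f : Fin n → ℚ) (i : Fin n) → (∀ r → r ≢ i → f r ≤ 0ℚ) → ∑ f ≤ f i
∑-≤-term {suc n} f Fin.zero    others≤0 =
  subst (∑ f ≤_) (ℚP.+-identityʳ _)
        (ℚP.+-monoʳ-≤ (f Fin.zero) (∑-nonPos _ (λ r → others≤0 (Fin.suc r) λ ())))
∑-≤-term {suc n} f (Fin.suc i) others≤0 =
  subst (∑ f ≤_) (ℚP.+-identityˡ _)
    (ℚP.+-mono-≤ (others≤0 Fin.zero λ ())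
                 (∑-≤-term _ i (λ r r≢i → others≤0 (Fin.suc r) (r≢i ∘ suc-injective))))

nonPos-terms-of-nonNeg-∑ : (f : Fin n → ℚ) → (∀ i → f i ≤ 0ℚ) → 0ℚ ≤ ∑ f → ∀ i → f i ≡ 0ℚ
nonPos-terms-of-nonNeg-∑ f f≤0 0≤∑f i =
  ℚP.≤-antisym (f≤0 i) (ℚP.≤-trans 0≤∑f (∑-≤-term f i (λ r _ → f≤0 r)))

Id-diag : (i : Fin ℓ) → Id ℓ i i ≡ 1ℚ
Id-diag i with toℕ i ℕ.≟ toℕ i
... | yes _   = refl
... | no i≢i = ⊥-elim (i≢i refl)

Id-offDiag : (i j : Fin ℓ) → i ≢ j → Id ℓ i j ≡ 0ℚ
Id-offDiag i j i≢j with toℕ i ℕ.≟ toℕ j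
... | yes i≡j = ⊥-elim (i≢j (toℕ-injective i≡j))
... | no _    = refl

Id-nonNeg : (i j : Fin ℓ) → 0ℚ ≤ Id ℓ i j
Id-nonNeg i j with toℕ i ℕ.≟ toℕ j
... | yes _ = ℚP.<⇒≤ (ℚP.positive⁻¹ 1ℚ)
... | no _  = ℚP.≤-refl

⊗-identityˡ : (A : Mat ℓ t) (i : Fin ℓ) (j : Fin t) → (Id ℓ ⊗ A) i j ≡ A i j
⊗-identityˡ A i j = begin
  ∑ (λ r → Id _ i r * A r j) ≡⟨ ∑-single _ i offDiag-terms ⟩
  Id _ i i * A i j           ≡⟨ cong (_* A i j) (Id-diag i) ⟩
  1ℚ * A i j                 ≡⟨ ℚP.*-identityˡ (A i j) ⟩
  A i j                      ∎
  where
  open ≡-Reasoning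
  offDiag-terms : ∀ r → r ≢ i → Id _ i r * A r j ≡ 0ℚ
  offDiag-terms r r≢i = trans (cong (_* A r j) (Id-offDiag i r (r≢i ∘ sym))) (ℚP.*-zeroˡ (A r j))

fromRow : ℕ → Fin ℓ → ℚ → ℚ
fromRow k i x with k ℕ.≤? toℕ i
... | yes _ = x
... | no _  = 0ℚ

fromRow-≥ : (i : Fin ℓ) (x : ℚ) → k ℕ.≤ toℕ i → fromRow k i x ≡ x
fromRow-≥ {k = k} i x k≤i with k ℕ.≤? toℕ i
... | yes _   = refl
... | no k≰i = ⊥-elim (k≰i k≤i)

fromRow-< : (i : Fin ℓ) (x : ℚ) → toℕ i ℕ.< k → fromRow k i x ≡ 0ℚ
fromRow-< {k = k} i x i<k with k ℕ.≤? toℕ i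
... | yes k≤i = ⊥-elim (ℕP.<⇒≱ i<k k≤i)
... | no _    = refl

fromRow-nonPos : (k : ℕ) (i : Fin ℓ) {x : ℚ} → x ≤ 0ℚ → fromRow k i x ≤ 0ℚ
fromRow-nonPos k i x≤0 with k ℕ.≤? toℕ i
... | yes _ = x≤0
... | no _  = ℚP.≤-refl

tailSum : ℕ → Mat ℓ t → Fin t → ℚ
tailSum k M j = ∑ (λ i → fromRow k i (M i j))

tailSum-from-0 : (M : Mat ℓ t) (j : Fin t) → tailSum 0 M j ≡ ∑ (λ i → M i j)
tailSum-from-0 M j = ∑-cong (λ i → fromRow-≥ i (M i j) z≤n)

tailSum-beyond : (M : Mat ℓ t) (j : Fin t) → ℓ ℕ.≤ k → tailSum k M j ≡ 0ℚ
tailSum-beyond M j ℓ≤k = ∑-zero _ (λ i → fromRow-< i (M i j) (ℕP.<-≤-trans (toℕ<n i) ℓ≤k))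

tailSum-suc : (M : Mat ℓ t) (j : Fin t) (K : Fin ℓ) → toℕ K ≡ k →
              tailSum k M j ≡ M K j + tailSum (suc k) M j
tailSum-suc {k = k} M j K K≡k = begin
  tailSum k M j                                ≡⟨ ∑-cong (λ i → x≡x-y+y (row k i) (row (suc k) i)) ⟩
  ∑ (λ i → δ i + row (suc k) i)                ≡⟨ ∑-+ δ (row (suc k)) ⟩
  ∑ δ + tailSum (suc k) M j                    ≡⟨ cong (_+ tailSum (suc k) M j) (∑-single δ K δ-others) ⟩
  δ K + tailSum (suc k) M j                    ≡⟨ cong (_+ tailSum (suc k) M j) δ-K ⟩
  M K j + tailSum (suc k) M j                  ∎
  where
  open ≡-Reasoning
  x≡x-y+y : ∀ x y → x ≡ (x - y) + y
  x≡x-y+y = solve 2 (λ x y → x := (x :- y) :+ y) refl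
  row : ℕ → Fin _ → ℚ
  row n i = fromRow n i (M i j)
  δ : Fin _ → ℚ
  δ i = row k i - row (suc k) i
  δ-K : δ K ≡ M K j
  δ-K = begin
    row k K - row (suc k) K ≡⟨ cong₂ _-_ (fromRow-≥ K _ (ℕP.≤-reflexive (sym K≡k)))
                                         (fromRow-< K _ (ℕP.≤-reflexive (cong suc K≡k))) ⟩
    M K j - 0ℚ              ≡⟨ ℚP.+-identityʳ (M K j) ⟩
    M K j                   ∎
  δ-others : ∀ r → r ≢ K → δ r ≡ 0ℚ
  δ-others r r≢K with ℕP.<-cmp (toℕ r) k
  ... | tri< r<k _ _ = trans (cong₂ _-_ (fromRow-< r _ r<k) (fromRow-< r _ (ℕP.m<n⇒m<1+n r<k)))
                             (ℚP.+-inverseʳ 0ℚ)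
  ... | tri≈ _ r≡k _ = ⊥-elim (r≢K (toℕ-injective (trans r≡k (sym K≡k))))
  ... | tri> _ _ k<r = trans (cong₂ _-_ (fromRow-≥ r _ (ℕP.<⇒≤ k<r)) (fromRow-≥ r _ k<r))
                             (ℚP.+-inverseʳ (M r j))

tailSum-suc-nonNeg : (M : Mat ℓ t) (j : Fin t) (K : Fin ℓ) → toℕ K ≡ k → M K j ≤ 0ℚ →
                     0ℚ ≤ tailSum k M j → 0ℚ ≤ tailSum (suc k) M j
tailSum-suc-nonNeg {k = k} M j K K≡k MKj≤0 0≤tail = ℚP.≤-trans 0≤tail (begin
  tailSum k M j                 ≡⟨ tailSum-suc M j K K≡k ⟩
  M K j + tailSum (suc k) M j   ≤⟨ ℚP.+-monoˡ-≤ (tailSum (suc k) M j) MKj≤0 ⟩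
  0ℚ + tailSum (suc k) M j      ≡⟨ ℚP.+-identityˡ _ ⟩
  tailSum (suc k) M j           ∎)
  where open ℚP.≤-Reasoning

-- The row operation of `pivotStep`, with c the pivot column and q the inverse of the pivot.
rowOp : (Fin ℓ → ℚ) → Fin ℓ → ℚ → Mat ℓ m → Mat ℓ m
rowOp c K q A i j with ℕP.<-cmp (toℕ i) (toℕ K)
... | tri< _ _ _ = A i j
... | tri≈ _ _ _ = A K j * q
... | tri> _ _ _ = A i j - c i * (A K j * q)

module _ (c : Fin ℓ → ℚ) (K : Fin ℓ) (q : ℚ) (A : Mat ℓ m) where

  rowOp-above : (i : Fin ℓ) (j : Fin m) → toℕ i ℕ.< toℕ K → rowOp c K q A i j ≡ A i j
  rowOp-above i j i<K with ℕP.<-cmp (toℕ i) (toℕ K)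
  ... | tri< _ _ _   = refl
  ... | tri≈ _ i≡K _ = ⊥-elim (ℕP.<⇒≢ i<K i≡K)
  ... | tri> _ _ K<i = ⊥-elim (ℕP.<-asym i<K K<i)

  rowOp-pivot : (j : Fin m) → rowOp c K q A K j ≡ A K j * q
  rowOp-pivot j with ℕP.<-cmp (toℕ K) (toℕ K)
  ... | tri< K<K _ _ = ⊥-elim (ℕP.<-irrefl refl K<K)
  ... | tri≈ _ _ _   = refl
  ... | tri> _ _ K<K = ⊥-elim (ℕP.<-irrefl refl K<K)

  rowOp-below : (i : Fin ℓ) (j : Fin m) → toℕ K ℕ.< toℕ i →
                rowOp c K q A i j ≡ A i j + (- c i) * (A K j * q)
  rowOp-below i j K<i with ℕP.<-cmp (toℕ i) (toℕ K)
  ... | tri< i<K _ _ = ⊥-elim (ℕP.<-asym i<K K<i)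
  ... | tri≈ _ i≡K _ = ⊥-elim (ℕP.<⇒≢ K<i (sym i≡K))
  ... | tri> _ _ _   = cong (A i j +_) (ℚP.neg-distribˡ-* (c i) (A K j * q))

  rowOp-nonNeg : (∀ i → toℕ K ℕ.< toℕ i → c i ≤ 0ℚ) → 0ℚ ≤ q → (∀ i j → 0ℚ ≤ A i j) →
                 ∀ i j → 0ℚ ≤ rowOp c K q A i j
  rowOp-nonNeg c≤0 0≤q 0≤A i j with ℕP.<-cmp (toℕ i) (toℕ K)
  ... | tri< _ _ _   = 0≤A i j
  ... | tri≈ _ _ _   = *-nonNeg (0≤A K j) 0≤q
  ... | tri> _ _ K<i = subst (0ℚ ≤_) (sym (cong (A i j +_) (ℚP.neg-distribˡ-* (c i) (A K j * q))))
                         (ℚP.+-mono-≤ (0≤A i j)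
                           (*-nonNeg (ℚP.neg-antimono-≤ (c≤0 i K<i)) (*-nonNeg (0≤A K j) 0≤q)))

rowOp-cong : (c : Fin ℓ → ℚ) (K : Fin ℓ) (q : ℚ) {A B : Mat ℓ m} → (∀ i j → A i j ≡ B i j) →
             ∀ i j → rowOp c K q A i j ≡ rowOp c K q B i j
rowOp-cong c K q A≗B i j with ℕP.<-cmp (toℕ i) (toℕ K)
... | tri< _ _ _ = A≗B i j
... | tri≈ _ _ _ = cong (_* q) (A≗B K j)
... | tri> _ _ _ = cong₂ (λ x y → x - c i * (y * q)) (A≗B i j) (A≗B K j)

rowOp-⊗ : (c : Fin ℓ → ℚ) (K : Fin ℓ) (q : ℚ) (A : Mat ℓ m) (B : Mat m t) →
          ∀ i j → rowOp c K q (A ⊗ B) i j ≡ (rowOp c K q A ⊗ B) i j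
rowOp-⊗ c K q A B i j with ℕP.<-cmp (toℕ i) (toℕ K)
... | tri< _ _ _ = refl
... | tri≈ _ _ _ = begin
  ∑ (λ r → A K r * B r j) * q     ≡⟨ ℚP.*-comm _ q ⟩
  q * ∑ (λ r → A K r * B r j)     ≡⟨ ∑-*ˡ q (λ r → A K r * B r j) ⟨
  ∑ (λ r → q * (A K r * B r j))   ≡⟨ ∑-cong (λ r → solve 3 (λ q a b → q :* (a :* b) := (a :* q) :* b)
                                                         refl q (A K r) (B r j)) ⟩
  ∑ (λ r → (A K r * q) * B r j)   ∎
  where open ≡-Reasoning
... | tri> _ _ _ = begin
  ∑ (λ r → A i r * B r j) - c i * (∑ (λ r → A K r * B r j) * q)
    ≡⟨ solve 4 (λ x c y q → x :- c :* (y :* q) := x :+ ((:- c) :* q) :* y)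
               refl (∑ (λ r → A i r * B r j)) (c i) (∑ (λ r → A K r * B r j)) q ⟩
  ∑ (λ r → A i r * B r j) + ((- c i) * q) * ∑ (λ r → A K r * B r j)
    ≡⟨ cong (∑ (λ r → A i r * B r j) +_) (∑-*ˡ ((- c i) * q) (λ r → A K r * B r j)) ⟨
  ∑ (λ r → A i r * B r j) + ∑ (λ r → ((- c i) * q) * (A K r * B r j))
    ≡⟨ ∑-+ (λ r → A i r * B r j) (λ r → ((- c i) * q) * (A K r * B r j)) ⟨
  ∑ (λ r → A i r * B r j + ((- c i) * q) * (A K r * B r j))
    ≡⟨ ∑-cong (λ r → solve 5 (λ x c y q b → x :* b :+ ((:- c) :* q) :* (y :* b)
                                            := (x :- c :* (y :* q)) :* b)
                             refl (A i r) (c i) (A K r) q (B r j)) ⟩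
  ∑ (λ r → (A i r - c i * (A K r * q)) * B r j)
    ∎
  where open ≡-Reasoning

tailSum-rowOp : (c : Fin ℓ → ℚ) (K : Fin ℓ) (q : ℚ) (A : Mat ℓ m) (j : Fin m) → toℕ K ≡ k →
                tailSum (suc k) (rowOp c K q A) j
                  ≡ tailSum (suc k) A j + (- (A K j * q)) * ∑ (λ i → fromRow (suc k) i (c i))
tailSum-rowOp {k = k} c K q A j K≡k = begin
  tailSum (suc k) (rowOp c K q A) j
    ≡⟨ ∑-cong rowwise ⟩
  ∑ (λ i → fromRow (suc k) i (A i j) + (- (A K j * q)) * fromRow (suc k) i (c i))
    ≡⟨ ∑-+ (λ i → fromRow (suc k) i (A i j)) (λ i → (- (A K j * q)) * fromRow (suc k) i (c i)) ⟩
  tailSum (suc k) A j + ∑ (λ i → (- (A K j * q)) * fromRow (suc k) i (c i))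
    ≡⟨ cong (tailSum (suc k) A j +_) (∑-*ˡ (- (A K j * q)) (λ i → fromRow (suc k) i (c i))) ⟩
  tailSum (suc k) A j + (- (A K j * q)) * ∑ (λ i → fromRow (suc k) i (c i))
    ∎
  where
  open ≡-Reasoning
  rowwise : ∀ i → fromRow (suc k) i (rowOp c K q A i j)
                  ≡ fromRow (suc k) i (A i j) + (- (A K j * q)) * fromRow (suc k) i (c i)
  rowwise i with suc k ℕ.≤? toℕ i
  ... | yes k<i = trans (rowOp-below c K q A i j (subst (ℕ._< toℕ i) (sym K≡k) k<i))
                        (solve 3 (λ x c y → x :+ (:- c) :* y := x :+ (:- y) :* c)
                                 refl (A i j) (c i) (A K j * q))
  ... | no _    = sym (trans (ℚP.+-identityˡ _) (ℚP.*-zeroʳ (- (A K j * q))))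

module _ (K : Fin ℓ) (C : Fin t) (M : Mat ℓ t) (Y : Mat ℓ ℓ) where

  pivotStep-zero : M K C ≡ 0ℚ → pivotStep K C (M , Y) ≡ (M , Y)
  pivotStep-zero p≡0 with M K C ℚP.≟ 0ℚ
  ... | yes _   = refl
  ... | no p≢0 = ⊥-elim (p≢0 p≡0)

  module _ (p≢0 : M K C ≢ 0ℚ) where

    private instance
      pivot-nonZero : NonZero (M K C)
      pivot-nonZero = ≢-nonZero p≢0

    pivotStep-matrix : ∀ i j → proj₁ (pivotStep K C (M , Y)) i j
                       ≡ rowOp (λ r → M r C) K (1/ M K C) M i j
    pivotStep-matrix i j with M K C ℚP.≟ 0ℚ
    ... | yes p≡0 = ⊥-elim (p≢0 p≡0)
    ... | no _ with ℕP.<-cmp (toℕ i) (toℕ K)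
    ... | tri< _ _ _ = refl
    ... | tri≈ _ _ _ = refl
    ... | tri> _ _ _ = refl

    pivotStep-transform : ∀ i j → proj₂ (pivotStep K C (M , Y)) i j
                          ≡ rowOp (λ r → M r C) K (1/ M K C) Y i j
    pivotStep-transform i j with M K C ℚP.≟ 0ℚ
    ... | yes p≡0 = ⊥-elim (p≢0 p≡0)
    ... | no _ with ℕP.<-cmp (toℕ i) (toℕ K)
    ... | tri< _ _ _ = refl
    ... | tri≈ _ _ _ = refl
    ... | tri> _ _ _ = refl

processed : ℓ ℕ.≤ k ⊎ t ℕ.≤ k → (i : Fin ℓ) (j : Fin t) → toℕ j ℕ.≤ toℕ i → toℕ j ℕ.< k
processed (inj₁ ℓ≤k) i j j≤i = ℕP.≤-<-trans j≤i (ℕP.<-≤-trans (toℕ<n i) ℓ≤k)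
processed (inj₂ t≤k) i j _   = ℕP.<-≤-trans (toℕ<n j) t≤k

module Elimination {ℓ t : ℕ} (T : Mat ℓ t) (T∈Z+ : InZ+ T) where

  record Invariant (k : ℕ) (M : Mat ℓ t) (Y : Mat ℓ ℓ) : Set where
    field
      factorisation    : ∀ i j → M i j ≡ (Y ⊗ T) i j
      transform-nonNeg : ∀ i j → 0ℚ ≤ Y i j
      offDiag-nonPos   : ∀ i j → toℕ i ≢ toℕ j → M i j ≤ 0ℚ
      cleared          : ∀ i j → toℕ j ℕ.< k → toℕ j ℕ.< toℕ i → M i j ≡ 0ℚ
      diag-0∨1         : ∀ i j → toℕ i ≡ toℕ j → toℕ i ℕ.< k → M i j ≡ 0ℚ ⊎ M i j ≡ 1ℚ
      tailSum-nonNeg   : ∀ j → k ℕ.≤ toℕ j → 0ℚ ≤ tailSum k M j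
      pending-≤        : ∀ i j → k ℕ.≤ toℕ j → toℕ j ℕ.< toℕ i → M i j ≤ T i j
      pivot-one        : ∀ j i → toℕ j ℕ.< toℕ i → toℕ j ℕ.< k → T i j < 0ℚ →
                         ∀ j′ → toℕ j′ ≡ toℕ j → M j′ j ≡ 1ℚ

  InvariantOn : ℕ → Mat ℓ t × Mat ℓ ℓ → Set
  InvariantOn k (M , Y) = Invariant k M Y

  Invariant-resp : ∀ {k M M′ Y Y′} → (∀ i j → M i j ≡ M′ i j) → (∀ i j → Y i j ≡ Y′ i j) →
                   Invariant k M Y → Invariant k M′ Y′
  Invariant-resp {k} M≗M′ Y≗Y′ I = record
    { factorisation    = λ i j → trans (sym (M≗M′ i j))
                                   (trans (factorisation i j) (∑-cong λ r → cong (_* T r j) (Y≗Y′ i r)))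
    ; transform-nonNeg = λ i j → subst (0ℚ ≤_) (Y≗Y′ i j) (transform-nonNeg i j)
    ; offDiag-nonPos   = λ i j i≢j → subst (_≤ 0ℚ) (M≗M′ i j) (offDiag-nonPos i j i≢j)
    ; cleared          = λ i j j<k j<i → trans (sym (M≗M′ i j)) (cleared i j j<k j<i)
    ; diag-0∨1         = λ i j i≡j i<k →
                           subst (λ x → x ≡ 0ℚ ⊎ x ≡ 1ℚ) (M≗M′ i j) (diag-0∨1 i j i≡j i<k)
    ; tailSum-nonNeg   = λ j k≤j → subst (0ℚ ≤_) (∑-cong λ i → cong (fromRow k i) (M≗M′ i j))
                                     (tailSum-nonNeg j k≤j)
    ; pending-≤        = λ i j k≤j j<i → subst (_≤ T i j) (M≗M′ i j) (pending-≤ i j k≤j j<i)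
    ; pivot-one        = λ j i j<i j<k Tij<0 j′ j′≡j →
                           trans (sym (M≗M′ j′ j)) (pivot-one j i j<i j<k Tij<0 j′ j′≡j)
    }
    where open Invariant I

  initial : Invariant 0 T (Id ℓ)
  initial = record
    { factorisation    = λ i j → sym (⊗-identityˡ T i j)
    ; transform-nonNeg = Id-nonNeg
    ; offDiag-nonPos   = proj₁ T∈Z+
    ; cleared          = λ _ _ ()
    ; diag-0∨1         = λ _ _ _ ()
    ; tailSum-nonNeg   = λ j _ → subst (0ℚ ≤_) (sym (tailSum-from-0 T j)) (proj₂ T∈Z+ j)
    ; pending-≤        = λ _ _ _ _ → ℚP.≤-refl
    ; pivot-one        = λ _ _ _ ()
    }

  skip : ∀ {k M Y} → ℓ ℕ.≤ k ⊎ t ℕ.≤ k → Invariant k M Y → Invariant (suc k) M Y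
  skip {k} {M} no-pivot I = record
    { factorisation    = factorisation
    ; transform-nonNeg = transform-nonNeg
    ; offDiag-nonPos   = offDiag-nonPos
    ; cleared          = λ i j _ j<i → cleared i j (processed no-pivot i j (ℕP.<⇒≤ j<i)) j<i
    ; diag-0∨1         = λ i j i≡j _ →
                           diag-0∨1 i j i≡j (subst (ℕ._< k) (sym i≡j)
                                              (processed no-pivot i j (ℕP.≤-reflexive (sym i≡j))))
    ; tailSum-nonNeg   = tailSum-nonNeg′ no-pivot
    ; pending-≤        = λ i j k<j j<i →
                           ⊥-elim (ℕP.<-asym k<j (processed no-pivot i j (ℕP.<⇒≤ j<i)))
    ; pivot-one        = λ j i j<i _ → pivot-one j i j<i (processed no-pivot i j (ℕP.<⇒≤ j<i))
    }
    where
    open Invariant I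
    tailSum-nonNeg′ : ℓ ℕ.≤ k ⊎ t ℕ.≤ k → ∀ j → suc k ℕ.≤ toℕ j → 0ℚ ≤ tailSum (suc k) M j
    tailSum-nonNeg′ (inj₁ ℓ≤k) j _   =
      ℚP.≤-reflexive (sym (tailSum-beyond M j (ℕP.m≤n⇒m≤1+n ℓ≤k)))
    tailSum-nonNeg′ (inj₂ t≤k) j k<j = ⊥-elim (ℕP.<-asym k<j (ℕP.<-≤-trans (toℕ<n j) t≤k))

  module Pivot (K : Fin ℓ) (C : Fin t) (C≡K : toℕ C ≡ toℕ K)
               {M : Mat ℓ t} {Y : Mat ℓ ℓ} (I : Invariant (toℕ K) M Y) where
    open Invariant I

    pivot-column : {j : Fin t} → toℕ j ≡ toℕ K → j ≡ C
    pivot-column j≡K = toℕ-injective (trans j≡K (sym C≡K))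

    processed-or-pivot : (j : Fin t) → toℕ j ℕ.< suc (toℕ K) → toℕ j ℕ.< toℕ K ⊎ j ≡ C
    processed-or-pivot j j≤K with ℕP.m<1+n⇒m<n∨m≡n j≤K
    ... | inj₁ j<K = inj₁ j<K
    ... | inj₂ j≡K = inj₂ (pivot-column j≡K)

    belowPivot-nonPos : ∀ i → toℕ K ℕ.< toℕ i → M i C ≤ 0ℚ
    belowPivot-nonPos i K<i = offDiag-nonPos i C (λ i≡C → ℕP.<⇒≢ K<i (sym (trans i≡C C≡K)))

    offPivot-nonPos : ∀ r → r ≢ K → fromRow (toℕ K) r (M r C) ≤ 0ℚ
    offPivot-nonPos r r≢K =
      fromRow-nonPos (toℕ K) r (offDiag-nonPos r C (λ r≡C → r≢K (toℕ-injective (trans r≡C C≡K))))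

    pivot-nonNeg : 0ℚ ≤ M K C
    pivot-nonNeg = ℚP.≤-trans (tailSum-nonNeg C (ℕP.≤-reflexive (sym C≡K)))
      (subst (tailSum (toℕ K) M C ≤_) (fromRow-≥ K (M K C) ℕP.≤-refl)
             (∑-≤-term _ K offPivot-nonPos))

    module _ (p≡0 : M K C ≡ 0ℚ) where

      belowZeroPivot : ∀ i → toℕ K ℕ.< toℕ i → M i C ≡ 0ℚ
      belowZeroPivot i K<i =
        trans (sym (fromRow-≥ i (M i C) (ℕP.<⇒≤ K<i)))
              (nonPos-terms-of-nonNeg-∑ _ column-nonPos (tailSum-nonNeg C (ℕP.≤-reflexive (sym C≡K))) i)
        where
        column-nonPos : ∀ r → fromRow (toℕ K) r (M r C) ≤ 0ℚ
        column-nonPos r with r FP.≟ K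
        ... | yes refl = fromRow-nonPos (toℕ K) K (ℚP.≤-reflexive p≡0)
        ... | no r≢K   = offPivot-nonPos r r≢K

      zero-pivot : Invariant (suc (toℕ K)) M Y
      zero-pivot = record
        { factorisation    = factorisation
        ; transform-nonNeg = transform-nonNeg
        ; offDiag-nonPos   = offDiag-nonPos
        ; cleared          = cleared′
        ; diag-0∨1         = diag-0∨1′
        ; tailSum-nonNeg   = λ j K<j → tailSum-suc-nonNeg M j K refl (offDiag-nonPos K j (ℕP.<⇒≢ K<j))
                                         (tailSum-nonNeg j (ℕP.<⇒≤ K<j))
        ; pending-≤        = λ i j K<j j<i → pending-≤ i j (ℕP.<⇒≤ K<j) j<i
        ; pivot-one        = pivot-one′
        }
        where
        cleared′ : ∀ i j → toℕ j ℕ.< suc (toℕ K) → toℕ j ℕ.< toℕ i → M i j ≡ 0ℚ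
        cleared′ i j j≤K j<i with processed-or-pivot j j≤K
        ... | inj₁ j<K  = cleared i j j<K j<i
        ... | inj₂ refl = belowZeroPivot i (subst (ℕ._< toℕ i) C≡K j<i)

        diag-0∨1′ : ∀ i j → toℕ i ≡ toℕ j → toℕ i ℕ.< suc (toℕ K) → M i j ≡ 0ℚ ⊎ M i j ≡ 1ℚ
        diag-0∨1′ i j i≡j i≤K with ℕP.m<1+n⇒m<n∨m≡n i≤K
        ... | inj₁ i<K = diag-0∨1 i j i≡j i<K
        ... | inj₂ i≡K with toℕ-injective {i = i} i≡K | pivot-column (trans (sym i≡j) i≡K)
        ...   | refl | refl = inj₁ p≡0

        pivot-one′ : ∀ j i → toℕ j ℕ.< toℕ i → toℕ j ℕ.< suc (toℕ K) → T i j < 0ℚ →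
                     ∀ j′ → toℕ j′ ≡ toℕ j → M j′ j ≡ 1ℚ
        pivot-one′ j i j<i j≤K Tij<0 j′ j′≡j with processed-or-pivot j j≤K
        ... | inj₁ j<K  = pivot-one j i j<i j<K Tij<0 j′ j′≡j
        ... | inj₂ refl = ⊥-elim (ℚP.<-irrefl refl (begin-strict
          0ℚ    ≡⟨ belowZeroPivot i K<i ⟨
          M i C ≤⟨ pending-≤ i C (ℕP.≤-reflexive (sym C≡K)) j<i ⟩
          T i C <⟨ Tij<0 ⟩
          0ℚ    ∎))
          where
          open ℚP.≤-Reasoning
          K<i : toℕ K ℕ.< toℕ i
          K<i = subst (ℕ._< toℕ i) C≡K j<i

    module _ (q : ℚ) (pq≡1 : M K C * q ≡ 1ℚ) where

      pivotColumn : Fin ℓ → ℚ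
      pivotColumn i = M i C

      M′ : Mat ℓ t
      M′ = rowOp pivotColumn K q M

      q-nonNeg : 0ℚ ≤ q
      q-nonNeg = inverse-nonNeg pivot-nonNeg pq≡1

      pivot-one-after : M′ K C ≡ 1ℚ
      pivot-one-after = trans (rowOp-pivot pivotColumn K q M C) pq≡1

      belowPivot-eliminated : ∀ i → toℕ K ℕ.< toℕ i → M′ i C ≡ 0ℚ
      belowPivot-eliminated i K<i = begin
        M′ i C                         ≡⟨ rowOp-below pivotColumn K q M i C K<i ⟩
        M i C + (- M i C) * (M K C * q) ≡⟨ cong (λ x → M i C + (- M i C) * x) pq≡1 ⟩
        M i C + (- M i C) * 1ℚ          ≡⟨ cong (M i C +_) (ℚP.*-identityʳ (- M i C)) ⟩
        M i C - M i C                   ≡⟨ ℚP.+-inverseʳ (M i C) ⟩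
        0ℚ                              ∎
        where open ≡-Reasoning

      below-decreases : ∀ i j → toℕ K ℕ.< toℕ i → toℕ K ≢ toℕ j → M′ i j ≤ M i j
      below-decreases i j K<i K≢j = subst (_≤ M i j) (sym (rowOp-below pivotColumn K q M i j K<i))
        (+-nonPos-≤ (*-nonNeg-nonPos (ℚP.neg-antimono-≤ (belowPivot-nonPos i K<i))
                                     (*-nonPos-nonNeg (offDiag-nonPos K j K≢j) q-nonNeg)))

      -- The new tail sum of column j is a nonnegative combination of two old ones (as p q = 1).
      tailSum-nonNeg-after : ∀ j → suc (toℕ K) ℕ.≤ toℕ j → 0ℚ ≤ tailSum (suc (toℕ K)) M′ j
      tailSum-nonNeg-after j K<j = begin
        0ℚ
          ≤⟨ ℚP.+-mono-≤ (tailSum-nonNeg j (ℕP.<⇒≤ K<j))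
                         (*-nonNeg (ℚP.neg-antimono-≤ (*-nonPos-nonNeg (offDiag-nonPos K j (ℕP.<⇒≢ K<j))
                                                                       q-nonNeg))
                                   (tailSum-nonNeg C (ℕP.≤-reflexive (sym C≡K)))) ⟩
        tailSum (toℕ K) M j + c * tailSum (toℕ K) M C
          ≡⟨ cong₂ (λ x y → x + c * y) (tailSum-suc M j K refl) (tailSum-suc M C K refl) ⟩
        (M K j + Sⱼ) + c * (M K C + S꜀)
          ≡⟨ solve 5 (λ a S p S′ q → (a :+ S) :+ (:- (a :* q)) :* (p :+ S′)
                                      := (S :+ (:- (a :* q)) :* S′) :+ a :* (con 1ℚ :- p :* q))
                     refl (M K j) Sⱼ (M K C) S꜀ q ⟩
        (Sⱼ + c * S꜀) + M K j * (1ℚ - M K C * q)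
          ≡⟨ cong (λ x → (Sⱼ + c * S꜀) + M K j * (1ℚ - x)) pq≡1 ⟩
        (Sⱼ + c * S꜀) + M K j * 0ℚ
          ≡⟨ trans (cong (Sⱼ + c * S꜀ +_) (ℚP.*-zeroʳ (M K j))) (ℚP.+-identityʳ _) ⟩
        Sⱼ + c * S꜀
          ≡⟨ tailSum-rowOp pivotColumn K q M j refl ⟨
        tailSum (suc (toℕ K)) M′ j
          ∎
        where
        open ℚP.≤-Reasoning
        c : ℚ
        c = - (M K j * q)
        Sⱼ S꜀ : ℚ
        Sⱼ = tailSum (suc (toℕ K)) M j
        S꜀ = tailSum (suc (toℕ K)) M C

      nonZero-pivot : Invariant (suc (toℕ K)) M′ (rowOp pivotColumn K q Y)
      nonZero-pivot = record
        { factorisation    = λ i j → trans (rowOp-cong pivotColumn K q factorisation i j)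
                                           (rowOp-⊗ pivotColumn K q Y T i j)
        ; transform-nonNeg = rowOp-nonNeg pivotColumn K q Y belowPivot-nonPos q-nonNeg transform-nonNeg
        ; offDiag-nonPos   = offDiag-nonPos′
        ; cleared          = cleared′
        ; diag-0∨1         = diag-0∨1′
        ; tailSum-nonNeg   = tailSum-nonNeg-after
        ; pending-≤        = λ i j K<j j<i →
                               ℚP.≤-trans (below-decreases i j (ℕP.<-trans K<j j<i) (ℕP.<⇒≢ K<j))
                                          (pending-≤ i j (ℕP.<⇒≤ K<j) j<i)
        ; pivot-one        = pivot-one′
        }
        where
        offDiag-nonPos′ : ∀ i j → toℕ i ≢ toℕ j → M′ i j ≤ 0ℚ
        offDiag-nonPos′ i j i≢j with FP.<-cmp i K | j FP.≟ C
        ... | tri< i<K _ _  | _        = subst (_≤ 0ℚ) (sym (rowOp-above pivotColumn K q M i j i<K))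
                                                 (offDiag-nonPos i j i≢j)
        ... | tri≈ _ refl _ | _        = subst (_≤ 0ℚ) (sym (rowOp-pivot pivotColumn K q M j))
                                                 (*-nonPos-nonNeg (offDiag-nonPos K j i≢j) q-nonNeg)
        ... | tri> _ _ K<i  | yes refl = ℚP.≤-reflexive (belowPivot-eliminated i K<i)
        ... | tri> _ _ K<i  | no j≢C   = ℚP.≤-trans (below-decreases i j K<i
                                                      (λ K≡j → j≢C (pivot-column (sym K≡j))))
                                                    (offDiag-nonPos i j i≢j)

        cleared′ : ∀ i j → toℕ j ℕ.< suc (toℕ K) → toℕ j ℕ.< toℕ i → M′ i j ≡ 0ℚ
        cleared′ i j j≤K j<i with FP.<-cmp i K | processed-or-pivot j j≤K
        ... | tri< i<K _ _  | _         = trans (rowOp-above pivotColumn K q M i j i<K)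
                                                (cleared i j (ℕP.<-trans j<i i<K) j<i)
        ... | tri≈ _ refl _ | _         = trans (rowOp-pivot pivotColumn K q M j)
                                                (trans (cong (_* q) (cleared K j j<i j<i)) (ℚP.*-zeroˡ q))
        ... | tri> _ _ K<i  | inj₁ j<K  = begin
          M′ i j                            ≡⟨ rowOp-below pivotColumn K q M i j K<i ⟩
          M i j + (- M i C) * (M K j * q)   ≡⟨ cong₂ (λ x y → x + (- M i C) * (y * q))
                                                     (cleared i j j<K j<i) (cleared K j j<K j<K) ⟩
          0ℚ + (- M i C) * (0ℚ * q)         ≡⟨ solve 2 (λ c q → con 0ℚ :+ c :* (con 0ℚ :* q) := con 0ℚ)
                                                       refl (- M i C) q ⟩
          0ℚ                                ∎
          where open ≡-Reasoning
        ... | tri> _ _ K<i  | inj₂ refl = belowPivot-eliminated i K<i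

        diag-0∨1′ : ∀ i j → toℕ i ≡ toℕ j → toℕ i ℕ.< suc (toℕ K) → M′ i j ≡ 0ℚ ⊎ M′ i j ≡ 1ℚ
        diag-0∨1′ i j i≡j i≤K with ℕP.m<1+n⇒m<n∨m≡n i≤K
        ... | inj₁ i<K = subst (λ x → x ≡ 0ℚ ⊎ x ≡ 1ℚ) (sym (rowOp-above pivotColumn K q M i j i<K))
                               (diag-0∨1 i j i≡j i<K)
        ... | inj₂ i≡K with toℕ-injective {i = i} i≡K | pivot-column (trans (sym i≡j) i≡K)
        ...   | refl | refl = inj₂ pivot-one-after

        pivot-one′ : ∀ j i → toℕ j ℕ.< toℕ i → toℕ j ℕ.< suc (toℕ K) → T i j < 0ℚ →
                     ∀ j′ → toℕ j′ ≡ toℕ j → M′ j′ j ≡ 1ℚ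
        pivot-one′ j i j<i j≤K Tij<0 j′ j′≡j with processed-or-pivot j j≤K
        ... | inj₁ j<K  = trans (rowOp-above pivotColumn K q M j′ j (subst (ℕ._< toℕ K) (sym j′≡j) j<K))
                                (pivot-one j i j<i j<K Tij<0 j′ j′≡j)
        ... | inj₂ refl with toℕ-injective {i = j′} (trans j′≡j C≡K)
        ...   | refl = pivot-one-after

  pivotStep-invariant : ∀ {k} (K : Fin ℓ) (C : Fin t) → toℕ K ≡ k → toℕ C ≡ k → ∀ {M Y} →
                        Invariant k M Y → InvariantOn (suc k) (pivotStep K C (M , Y))
  pivotStep-invariant K C refl C≡K {M} {Y} I = by-cases (M K C ℚP.≟ 0ℚ)
    where
    open Pivot K C C≡K I
    by-cases : Dec (M K C ≡ 0ℚ) → InvariantOn (suc (toℕ K)) (pivotStep K C (M , Y))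
    by-cases (yes p≡0) = subst (InvariantOn (suc (toℕ K))) (sym (pivotStep-zero K C M Y p≡0))
                               (zero-pivot p≡0)
    by-cases (no p≢0)  = Invariant-resp (λ i j → sym (pivotStep-matrix K C M Y p≢0 i j))
                                        (λ i j → sym (pivotStep-transform K C M Y p≢0 i j))
                                        (nonZero-pivot (1/_ (M K C) {{≢-nonZero p≢0}})
                                                       (ℚP.*-inverseʳ (M K C) {{≢-nonZero p≢0}}))

  step-invariant : ∀ k s → InvariantOn k s → InvariantOn (suc k) (stepℕ k s)
  step-invariant k (M , Y) I with k ℕ.<? ℓ | k ℕ.<? t
  ... | yes k<ℓ | yes k<t = pivotStep-invariant (fromℕ< k<ℓ) (fromℕ< k<t)
                              (toℕ-fromℕ< k<ℓ) (toℕ-fromℕ< k<t) I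
  ... | no k≮ℓ  | _       = skip (inj₁ (ℕP.≮⇒≥ k≮ℓ)) I
  ... | yes _   | no k≮t  = skip (inj₂ (ℕP.≮⇒≥ k≮t)) I

  loop-invariant : ∀ n k s → InvariantOn k s → InvariantOn (n ℕ.+ k) (loop n k s)
  loop-invariant zero    k s I = I
  loop-invariant (suc n) k s I =
    subst (λ m → InvariantOn m (loop n (suc k) (stepℕ k s))) (ℕP.+-suc n k)
          (loop-invariant n (suc k) (stepℕ k s) (step-invariant k s I))

  gauss-invariant : InvariantOn ℓ (gauss T)
  gauss-invariant = subst (λ m → InvariantOn m (gauss T)) (ℕP.+-identityʳ ℓ)
                          (loop-invariant ℓ 0 (T , Id ℓ) initial)

lemma7p2 : (ℓ t : ℕ) (T : Mat ℓ t) → InZ+ T →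
    -- T' = Y T
    (∀ (i : Fin ℓ) (j : Fin t) → gaussT' T i j ≡ (gaussY T ⊗ T) i j)
    -- T' upper triangular
    × (∀ (i : Fin ℓ) (j : Fin t) → toℕ j ℕ.< toℕ i → gaussT' T i j ≡ 0ℚ)
    -- diagonal entries of T' are 0 or 1
    × (∀ (i : Fin ℓ) (j : Fin t) → toℕ i ≡ toℕ j →
         gaussT' T i j ≡ 0ℚ ⊎ gaussT' T i j ≡ 1ℚ)
    -- off-diagonal entries of T' nonpositive
    × (∀ (i : Fin ℓ) (j : Fin t) → toℕ i ≢ toℕ j → gaussT' T i j ≤ 0ℚ)
    -- Y entrywise nonnegative
    × (∀ (i j : Fin ℓ) → 0ℚ ≤ gaussY T i j)
    -- if T_{ik} < 0 with i > k, then T'_{kk} = 1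
    × (∀ (k : Fin t) (i : Fin ℓ) → toℕ k ℕ.< toℕ i → T i k < 0ℚ →
         ∀ (k' : Fin ℓ) → toℕ k' ≡ toℕ k → gaussT' T k' k ≡ 1ℚ)
lemma7p2 ℓ t T T∈Z+ =
    factorisation
  , (λ i j j<i → cleared i j (every-column j<i) j<i)
  , (λ i j i≡j → diag-0∨1 i j i≡j (toℕ<n i))
  , offDiag-nonPos
  , transform-nonNeg
  , (λ k i k<i → pivot-one k i k<i (every-column k<i))
  where
  open Elimination T T∈Z+ using (module Invariant; gauss-invariant)
  open Invariant gauss-invariant
  every-column : ∀ {i : Fin ℓ} {j : Fin t} → toℕ j ℕ.< toℕ i → toℕ j ℕ.< ℓ
  every-column {i} j<i = ℕP.<-trans j<i (toℕ<n i)
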